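{- For any spanoids $\mathcal S_1,\mathcal S_2$ on finite sets $X_1,X_2$, $\mathrm{LP}^{entropy}(\mathcal S_1\ltimes\mathcal S_2)\le\mathrm{LP}^{entropy}(\mathcal S_1)\,\mathrm{LP}^{entropy}(\mathcal S_2)$.
   Context: A spanoid $\mathcal S$ on a finite set $X$ is a family of pairs $(S,i)$ with $S\subseteq X$, $i\in X$ (rules). For $T\subseteq X$, $i\in X$ write $T\models i$ if there is a sequence $T=T_0,\dots,T_r$ ($r\ge0$) with $i\in T_r$ such that for each $j\in[r]$, $T_j=T_{j-1}\cup\{i_j\}$ where some $S\subseteq T_{j-1}$ has $(S,i_j)\in\mathcal S$. $\mathrm{LP}^{entropy}(\mathcal S)$ is the maximum of $f(X)$ over all $f:2^X\to\mathbb R$ with: $f(\emptyset)=0$; $f(\{i\})\le1$ for all $i\in X$; $f(A\cup B)+f(A\cap B)\le f(A)+f(B)$ for all $A,B\subseteq X$; $f(A)\le f(B)$ whenever $A\subseteq B$; and $f(A\cup\{i\})=f(A)$ whenever $A\models i$ in $\mathcal S$. The semi-direct product $\mathcal S_1\ltimes\mathcal S_2$ is the spanoid on $X_1\times X_2$ with the rules: (1) for $A\subseteq X_1$, $i\in X_1$ with $A\models i$ in $\mathcal S_1$, and every $j\in X_2$, the rule $A\times X_2\to(i,j)$; (2) for $B\subseteq X_2$, $j\in X_2$ with $B\models j$ in $\mathcal S_2$, and every $i\in X_1$, the rule $\{i\}\times B\to(i,j)$.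
   Formalization: The functions $f$ in the definition of $\mathrm{LP}^{entropy}$ take values in ℚ instead of ℝ. -}

module Defs where

open import Data.Bool using (Bool; true; false; T; _∨_; _∧_)
open import Data.Product using (Σ; ∃; _×_; _,_)
open import Data.Product.Properties using (≡-dec)
open import Data.Sum using (_⊎_)
open import Data.Fin using (Fin)
open import Data.Nat using (ℕ)
open import Data.Rational using (ℚ; _≤_; _+_; _*_; 0ℚ; 1ℚ)
open import Relation.Binary.Definitions using (DecidableEquality)
open import Relation.Binary.PropositionalEquality using (_≡_)
open import Relation.Nullary.Decidable using (does)

Sub : Set → Set
Sub X = X → Bool

module _ {X : Set} where
  ∅ : Sub X
  ∅ _ = false

  full : Sub X
  full _ = true

  _∪_ : Sub X → Sub X → Sub X
  (A ∪ B) x = A x ∨ B x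

  _∩_ : Sub X → Sub X → Sub X
  (A ∩ B) x = A x ∧ B x

  _⊆_ : Sub X → Sub X → Set
  A ⊆ B = ∀ x → T (A x) → T (B x)

  _≐_ : Sub X → Sub X → Set
  A ≐ B = ∀ x → A x ≡ B x

  ⁅_⁆ : DecidableEquality X → X → Sub X
  ⁅ dec ⁆ i x = does (dec x i)

-- A spanoid on X: the family of its rules (S , i), given as a predicate.
Spanoid : Set → Set₁
Spanoid X = Sub X → X → Set

-- T ⊨ i : derivation by a sequence T = T₀ ⊆ T₁ ⊆ … ⊆ Tᵣ ∋ i,
-- T_j = T_{j-1} ∪ {i_j} with some rule (S , i_j), S ⊆ T_{j-1}.
data Derives {X : Set} (dec : DecidableEquality X) (𝒮 : Spanoid X) : Sub X → X → Set where
  here : ∀ {A i} → T (A i) → Derives dec 𝒮 A i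
  step : ∀ {A S k i} → 𝒮 S k → S ⊆ A → Derives dec 𝒮 (A ∪ ⁅ dec ⁆ k) i → Derives dec 𝒮 A i

record EntropyFeasible {X : Set} (dec : DecidableEquality X) (𝒮 : Spanoid X)
                       (f : Sub X → ℚ) : Set where
  field
    empty     : f ∅ ≡ 0ℚ
    singleton : ∀ i → f (⁅ dec ⁆ i) ≤ 1ℚ
    submod    : ∀ A B → f (A ∪ B) + f (A ∩ B) ≤ f A + f B
    monotone  : ∀ A B → A ⊆ B → f A ≤ f B
    closed    : ∀ A i → Derives dec 𝒮 A i → f (A ∪ ⁅ dec ⁆ i) ≡ f A

IsLPEntropy : {X : Set} → DecidableEquality X → Spanoid X → ℚ → Set
IsLPEntropy dec 𝒮 v =
  (Σ (Sub _ → ℚ) λ f → EntropyFeasible dec 𝒮 f × f full ≡ v)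
  × (∀ f → EntropyFeasible dec 𝒮 f → f full ≤ v)

semidirect : {X₁ X₂ : Set} → DecidableEquality X₁ → DecidableEquality X₂ →
             Spanoid X₁ → Spanoid X₂ → Spanoid (X₁ × X₂)
semidirect {X₁} {X₂} dec₁ dec₂ 𝒮₁ 𝒮₂ P (i , j) =
  (Σ (Sub X₁) λ A → Derives dec₁ 𝒮₁ A i × (P ≐ λ { (a , b) → A a }))
  ⊎ (Σ (Sub X₂) λ B → Derives dec₂ 𝒮₂ B j × (P ≐ λ { (a , b) → ⁅ dec₁ ⁆ i a ∧ B b }))

×-dec : {X₁ X₂ : Set} → DecidableEquality X₁ → DecidableEquality X₂ → DecidableEquality (X₁ × X₂)
×-dec d₁ d₂ = ≡-dec d₁ d₂

{-# OPTIONS --safe #-}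
module Submission where

-- Let f be feasible for 𝒮₁ ⋉ 𝒮₂. For each i the slice B ↦ f({i} × B) is feasible for 𝒮₂ (rule (2)
-- turns B ⊨ j into {i} × B ⊨ (i , j)), so f({i} × X₂) ≤ v₂. The cylinder A ↦ f(A × X₂) satisfies
-- every constraint for 𝒮₁ except the normalisation (by rule (1), A ⊨ i makes the whole fibre
-- {i} × X₂ derivable from A × X₂), and its singletons are at most v₂. Hence l · f(A × X₂) is
-- feasible for 𝒮₁ whenever l ≥ 0 and l v₂ ≤ 1, so l f(X) ≤ v₁: l = 1/v₂ gives f(X) ≤ v₁ v₂, and
-- if v₂ = 0 arbitrarily large l force f(X) ≤ 0.

open import Defs
open import Data.Nat using (ℕ)
open import Data.Fin using (Fin; _≟_)
open import Data.Rational using (ℚ; _≤_; _*_)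

open import Data.Bool using (T; _∧_)
open import Data.Bool.Properties
  using (T-∨; T-∧; ∨-assoc; ∨-identityʳ; ∧-identityʳ; ∧-distribˡ-∨; ∧-distribʳ-∨)
open import Data.Empty using (⊥-elim)
open import Data.List using (List; []; _∷_; [_]; map; allFin)
open import Data.List.Membership.Propositional using (_∈_)
open import Data.List.Membership.Propositional.Properties using (∈-map⁺; ∈-allFin)
open import Data.List.Relation.Unary.All using (All; []; _∷_; universal)
open import Data.List.Relation.Unary.All.Properties using (map⁺)
open import Data.List.Relation.Unary.Any using (here; there)
open import Data.Product as Product using (_×_; _,_; proj₁; proj₂)
open import Data.Rational
  using (_+_; 0ℚ; 1ℚ; _<_; 1/_; Positive; NonZero; NonNegative; positive; nonNegative)
open import Data.Rational.Properties
  using (≤-refl; ≤-reflexive; ≤-trans; ≤-antisym; <⇒≤; <-≤-trans; ≤-<-trans; <-irrefl; <-respˡ-≡;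
         ≰⇒>; _≤?_; <-cmp; +-mono-≤; +-monoʳ-<; +-identityʳ; *-assoc; *-comm; *-identityˡ; *-identityʳ;
         *-zeroˡ; *-zeroʳ; *-distribˡ-+; *-inverseˡ; *-inverseʳ; *-monoˡ-≤-nonNeg;
         pos⇒nonZero; positive⁻¹; 1/pos⇒pos; pos*pos⇒pos; module ≤-Reasoning)
open import Data.Sum using (inj₁; inj₂)
import Data.Sum as Sum
open import Function using (_∘_; Equivalence)
open import Relation.Binary.Definitions using (DecidableEquality; tri<; tri≈; tri>)
open import Relation.Binary.PropositionalEquality
  using (_≡_; refl; sym; trans; cong; subst; module ≡-Reasoning)
open import Relation.Nullary using (yes; no)
open import Relation.Nullary.Decidable using (dec-true)

open Equivalence using (to; from)

0≤1 : 0ℚ ≤ 1ℚ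
0≤1 = <⇒≤ (positive⁻¹ 1ℚ)

bounded-multiples⇒nonPos : ∀ {x c} → (∀ l → 0ℚ ≤ l → l * x ≤ c) → x ≤ 0ℚ
bounded-multiples⇒nonPos {x} {c} bound with x ≤? 0ℚ
... | yes x≤0 = x≤0
... | no x≰0 = ⊥-elim (<-irrefl refl (<-≤-trans c<c+1 c+1≤c))
  where
  c≥0 : 0ℚ ≤ c
  c≥0 = subst (_≤ c) (*-zeroˡ x) (bound 0ℚ ≤-refl)
  c<c+1 : c < c + 1ℚ
  c<c+1 = <-respˡ-≡ (+-identityʳ c) (+-monoʳ-< c (positive⁻¹ 1ℚ))
  instance
    x-pos : Positive x
    x-pos = positive (≰⇒> x≰0)
    x-nonZero : NonZero x
    x-nonZero = pos⇒nonZero x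
    c+1-pos : Positive (c + 1ℚ)
    c+1-pos = positive (≤-<-trans c≥0 c<c+1)
  l : ℚ
  l = (c + 1ℚ) * 1/ x
  l*x≡c+1 : l * x ≡ c + 1ℚ
  l*x≡c+1 = begin
    (c + 1ℚ) * 1/ x * x     ≡⟨ *-assoc (c + 1ℚ) (1/ x) x ⟩
    (c + 1ℚ) * (1/ x * x)   ≡⟨ cong ((c + 1ℚ) *_) (*-inverseˡ x) ⟩
    (c + 1ℚ) * 1ℚ           ≡⟨ *-identityʳ (c + 1ℚ) ⟩
    c + 1ℚ                  ∎
    where open ≡-Reasoning
  c+1≤c : c + 1ℚ ≤ c
  c+1≤c = subst (_≤ c) l*x≡c+1 (bound l l≥0)
    where
    l≥0 : 0ℚ ≤ l
    l≥0 = <⇒≤ (positive⁻¹ l {{pos*pos⇒pos (c + 1ℚ) (1/ x) {{1/pos⇒pos x}}}})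

≤-*-by-scaling : ∀ {x v₁ v₂} → 0ℚ ≤ v₂ → (∀ l → 0ℚ ≤ l → l * v₂ ≤ 1ℚ → l * x ≤ v₁) → x ≤ v₁ * v₂
≤-*-by-scaling {x} {v₁} {v₂} v₂≥0 bound with <-cmp 0ℚ v₂
... | tri< v₂>0 _ _ = begin
  x                 ≡⟨ *-identityˡ x ⟨
  1ℚ * x            ≡⟨ cong (_* x) (*-inverseʳ v₂) ⟨
  v₂ * 1/ v₂ * x    ≡⟨ *-assoc v₂ (1/ v₂) x ⟩
  v₂ * (1/ v₂ * x)  ≤⟨ *-monoˡ-≤-nonNeg v₂ (bound (1/ v₂) 1/v₂≥0 (≤-reflexive (*-inverseˡ v₂))) ⟩
  v₂ * v₁           ≡⟨ *-comm v₂ v₁ ⟩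
  v₁ * v₂           ∎
  where
  open ≤-Reasoning
  instance
    v₂-pos : Positive v₂
    v₂-pos = positive v₂>0
    v₂-nonZero : NonZero v₂
    v₂-nonZero = pos⇒nonZero v₂
    v₂-nonNeg : NonNegative v₂
    v₂-nonNeg = nonNegative v₂≥0
  1/v₂≥0 : 0ℚ ≤ 1/ v₂
  1/v₂≥0 = <⇒≤ (positive⁻¹ (1/ v₂) {{1/pos⇒pos v₂}})
... | tri≈ _ refl _ = subst (x ≤_) (sym (*-zeroʳ v₁))
        (bounded-multiples⇒nonPos λ l l≥0 → bound l l≥0 (≤-trans (≤-reflexive (*-zeroʳ l)) 0≤1))
... | tri> _ _ v₂<0 = ⊥-elim (<-irrefl refl (<-≤-trans v₂<0 v₂≥0))

private
  variable
    X : Set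
    A B C : Sub X

⊆-refl : A ⊆ A
⊆-refl _ t = t

∪-⊆ˡ : A ⊆ (A ∪ B)
∪-⊆ˡ _ = from T-∨ ∘ inj₁

∩-⊆ˡ : (A ∩ B) ⊆ A
∩-⊆ˡ _ = proj₁ ∘ to T-∧

∩-⊆ʳ : (A ∩ B) ⊆ B
∩-⊆ʳ _ = proj₂ ∘ to T-∧

∪-monoˡ : A ⊆ B → (A ∪ C) ⊆ (B ∪ C)
∪-monoˡ A⊆B x = from T-∨ ∘ Sum.map₁ (A⊆B x) ∘ to T-∨

∪-monoʳ : B ⊆ C → (A ∪ B) ⊆ (A ∪ C)
∪-monoʳ B⊆C x = from T-∨ ∘ Sum.map₂ (B⊆C x) ∘ to T-∨

≐⇒⊆ : A ≐ B → A ⊆ B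
≐⇒⊆ A≐B x = subst T (A≐B x)

module _ {X : Set} (dec : DecidableEquality X) where

  ⁅⁆-sound : ∀ {i x} → T (⁅ dec ⁆ i x) → x ≡ i
  ⁅⁆-sound {i} {x} x∈⁅i⁆ with dec x i
  ... | yes x≡i = x≡i

  ⁅⁆-complete : ∀ {i x} → x ≡ i → T (⁅ dec ⁆ i x)
  ⁅⁆-complete {i} refl = subst T (sym (dec-true (dec i i) refl)) _

  fromList : List X → Sub X
  fromList []       = ∅
  fromList (y ∷ ys) = fromList ys ∪ ⁅ dec ⁆ y

  ∈⇒fromList : ∀ {x ys} → x ∈ ys → T (fromList ys x)
  ∈⇒fromList {ys = y ∷ ys} (here x≡y)  = from T-∨ (inj₂ (⁅⁆-complete x≡y))
  ∈⇒fromList {ys = y ∷ ys} (there x∈ys) = from T-∨ (inj₁ (∈⇒fromList x∈ys))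

  module _ {𝒮 : Spanoid X} where

    rule⇒Derives : ∀ {S A i} → 𝒮 S i → S ⊆ A → Derives dec 𝒮 A i
    rule⇒Derives r S⊆A = step r S⊆A (here (from T-∨ (inj₂ (⁅⁆-complete refl))))

    Derives-mono : ∀ {A C i} → A ⊆ C → Derives dec 𝒮 A i → Derives dec 𝒮 C i
    Derives-mono A⊆C (here i∈A)      = here (A⊆C _ i∈A)
    Derives-mono A⊆C (step r S⊆A d) = step r (λ x → A⊆C x ∘ S⊆A x) (Derives-mono (∪-monoˡ A⊆C) d)

-- EntropyFeasible without the normalisation f {i} ≤ 1: the part of the LP that survives scaling
-- and pulling back along join morphisms.
record IsClosedPolymatroid {X : Set} (dec : DecidableEquality X) (𝒮 : Spanoid X)
                           (f : Sub X → ℚ) : Set where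
  field
    empty    : f ∅ ≡ 0ℚ
    submod   : ∀ A B → f (A ∪ B) + f (A ∩ B) ≤ f A + f B
    monotone : ∀ A B → A ⊆ B → f A ≤ f B
    closed   : ∀ A i → Derives dec 𝒮 A i → f (A ∪ ⁅ dec ⁆ i) ≡ f A

module _ {X : Set} {dec : DecidableEquality X} {𝒮 : Spanoid X} {f : Sub X → ℚ} where

  feasible⇒polymatroid : EntropyFeasible dec 𝒮 f → IsClosedPolymatroid dec 𝒮 f
  feasible⇒polymatroid F = record
    { empty = empty ; submod = submod ; monotone = monotone ; closed = closed }
    where open EntropyFeasible F

  polymatroid⇒feasible : IsClosedPolymatroid dec 𝒮 f → (∀ i → f (⁅ dec ⁆ i) ≤ 1ℚ) →
                         EntropyFeasible dec 𝒮 f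
  polymatroid⇒feasible P f⁅⁆≤1 = record
    { empty = empty ; singleton = f⁅⁆≤1 ; submod = submod ; monotone = monotone ; closed = closed }
    where open IsClosedPolymatroid P

  scale-polymatroid : ∀ {l} → 0ℚ ≤ l → IsClosedPolymatroid dec 𝒮 f →
                      IsClosedPolymatroid dec 𝒮 (λ A → l * f A)
  scale-polymatroid {l} l≥0 P = record
    { empty    = trans (cong (l *_) empty) (*-zeroʳ l)
    ; submod   = λ A B → begin
        l * f (A ∪ B) + l * f (A ∩ B) ≡⟨ *-distribˡ-+ l _ _ ⟨
        l * (f (A ∪ B) + f (A ∩ B))   ≤⟨ *-monoˡ-≤-nonNeg l (submod A B) ⟩
        l * (f A + f B)               ≡⟨ *-distribˡ-+ l _ _ ⟩
        l * f A + l * f B             ∎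
    ; monotone = λ A B A⊆B → *-monoˡ-≤-nonNeg l (monotone A B A⊆B)
    ; closed   = λ A i d → cong (l *_) (closed A i d)
    }
    where
    open IsClosedPolymatroid P
    open ≤-Reasoning
    instance
      l-nonNeg = nonNegative l≥0

  module _ (P : IsClosedPolymatroid dec 𝒮 f) where
    open IsClosedPolymatroid P

    private
      absorb-fromList : ∀ {A} ys → All (Derives dec 𝒮 A) ys → f (A ∪ fromList dec ys) ≤ f A
      absorb-fromList {A} [] [] = monotone _ _ (≐⇒⊆ (∨-identityʳ ∘ A))
      absorb-fromList {A} (y ∷ ys) (d ∷ ds) = begin
        f (A ∪ (F ∪ ⁅ dec ⁆ y))  ≤⟨ monotone _ _ (≐⇒⊆ λ x → sym (∨-assoc (A x) (F x) _)) ⟩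
        f ((A ∪ F) ∪ ⁅ dec ⁆ y)  ≡⟨ closed _ y (Derives-mono dec ∪-⊆ˡ d) ⟩
        f (A ∪ F)                ≤⟨ absorb-fromList ys ds ⟩
        f A                      ∎
        where
        open ≤-Reasoning
        F = fromList dec ys

    absorb : ∀ {A B} ys → (∀ x → T (B x) → x ∈ ys) → All (Derives dec 𝒮 A) ys → f (A ∪ B) ≤ f A
    absorb ys B⊆ys ds =
      ≤-trans (monotone _ _ (∪-monoʳ λ x → ∈⇒fromList dec ∘ B⊆ys x)) (absorb-fromList ys ds)

record IsJoinMorphism {X Y : Set} (φ : Sub Y → Sub X) : Set where
  field
    map-∅    : φ ∅ ⊆ ∅
    map-∪    : ∀ A B → φ (A ∪ B) ⊆ (φ A ∪ φ B)
    map-mono : ∀ {A B} → A ⊆ B → φ A ⊆ φ B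

module _ {X Y : Set} {dec : DecidableEquality X} {dec′ : DecidableEquality Y}
         {𝒮 : Spanoid X} {𝒮′ : Spanoid Y} {f : Sub X → ℚ} {φ : Sub Y → Sub X} where

  pullback-polymatroid : IsClosedPolymatroid dec 𝒮 f → IsJoinMorphism φ →
    (∀ A y → Derives dec′ 𝒮′ A y → f (φ A ∪ φ (⁅ dec′ ⁆ y)) ≤ f (φ A)) →
    IsClosedPolymatroid dec′ 𝒮′ (f ∘ φ)
  pullback-polymatroid P J absorbs = record
    { empty    = ≤-antisym (≤-trans (monotone _ _ map-∅) (≤-reflexive empty))
                           (≤-trans (≤-reflexive (sym empty)) (monotone _ _ λ _ ()))
    ; submod   = λ A B → ≤-trans (+-mono-≤ (monotone _ _ (map-∪ A B)) (monotone _ _ (φ-∩ A B)))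
                                 (submod (φ A) (φ B))
    ; monotone = λ A B A⊆B → monotone _ _ (map-mono A⊆B)
    ; closed   = λ A y d → ≤-antisym (≤-trans (monotone _ _ (map-∪ A _)) (absorbs A y d))
                                     (monotone _ _ (map-mono ∪-⊆ˡ))
    }
    where
    open IsClosedPolymatroid P
    open IsJoinMorphism J
    φ-∩ : ∀ A B → φ (A ∩ B) ⊆ (φ A ∩ φ B)
    φ-∩ A B x t = from T-∧ (map-mono ∩-⊆ˡ x t , map-mono ∩-⊆ʳ x t)

module _ {X₁ X₂ : Set} where

  infix 30 _⊗_

  _⊗_ : Sub X₁ → Sub X₂ → Sub (X₁ × X₂)
  (A ⊗ B) (a , b) = A a ∧ B b

  ⊗-monoʳ : ∀ {A B C} → B ⊆ C → A ⊗ B ⊆ A ⊗ C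
  ⊗-monoʳ B⊆C (a , b) = from T-∧ ∘ Product.map₂ (B⊆C b) ∘ to T-∧

  ⊗-monoˡ : ∀ {A B C} → A ⊆ B → A ⊗ C ⊆ B ⊗ C
  ⊗-monoˡ A⊆B (a , b) = from T-∧ ∘ Product.map₁ (A⊆B a) ∘ to T-∧

  ⊗-isJoinMorphismʳ : ∀ A → IsJoinMorphism (A ⊗_)
  ⊗-isJoinMorphismʳ A = record
    { map-∅    = λ _ → proj₂ ∘ to T-∧
    ; map-∪    = λ B C → ≐⇒⊆ λ { (a , b) → ∧-distribˡ-∨ (A a) (B b) (C b) }
    ; map-mono = ⊗-monoʳ
    }

  ⊗-isJoinMorphismˡ : ∀ C → IsJoinMorphism (_⊗ C)
  ⊗-isJoinMorphismˡ C = record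
    { map-∅    = λ _ ()
    ; map-∪    = λ A B → ≐⇒⊆ λ { (a , b) → ∧-distribʳ-∨ (C b) (A a) (B a) }
    ; map-mono = ⊗-monoˡ
    }

module SemidirectProduct {X₁ X₂ : Set} (dec₁ : DecidableEquality X₁) (dec₂ : DecidableEquality X₂)
                         (𝒮₁ : Spanoid X₁) (𝒮₂ : Spanoid X₂) where

  private
    dec = ×-dec dec₁ dec₂
    𝒮 = semidirect dec₁ dec₂ 𝒮₁ 𝒮₂

  ⁅⁆-⊗-sound : ∀ {i j x} → T ((⁅ dec₁ ⁆ i ⊗ ⁅ dec₂ ⁆ j) x) → x ≡ (i , j)
  ⁅⁆-⊗-sound {i} {j} {a , b} t
    with ⁅⁆-sound dec₁ {i} {a} (proj₁ (to T-∧ t)) | ⁅⁆-sound dec₂ {j} {b} (proj₂ (to T-∧ t))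
  ... | refl | refl = refl

  module _ {f : Sub (X₁ × X₂) → ℚ} (P : IsClosedPolymatroid dec 𝒮 f) where

    slice-polymatroid : ∀ i → IsClosedPolymatroid dec₂ 𝒮₂ (λ B → f (⁅ dec₁ ⁆ i ⊗ B))
    slice-polymatroid i = pullback-polymatroid P (⊗-isJoinMorphismʳ _) λ B j d →
      absorb P [ i , j ] (λ x t → here (⁅⁆-⊗-sound t))
        (rule⇒Derives dec (inj₂ (B , d , λ _ → refl)) ⊆-refl ∷ [])

    cylinder-polymatroid : (xs : List X₂) → (∀ j → j ∈ xs) →
                           IsClosedPolymatroid dec₁ 𝒮₁ (λ A → f (A ⊗ full))
    cylinder-polymatroid xs complete = pullback-polymatroid P (⊗-isJoinMorphismˡ full) absorbs
      where
      fibre⊆ : ∀ {i} x → T ((⁅ dec₁ ⁆ i ⊗ full) x) → x ∈ map (i ,_) xs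
      fibre⊆ {i} (a , b) t with ⁅⁆-sound dec₁ {i} {a} (proj₁ (to T-∧ t))
      ... | refl = ∈-map⁺ (a ,_) (complete b)

      absorbs : ∀ A i → Derives dec₁ 𝒮₁ A i → f (A ⊗ full ∪ ⁅ dec₁ ⁆ i ⊗ full) ≤ f (A ⊗ full)
      absorbs A i d = absorb P (map (i ,_) xs) fibre⊆ (map⁺ (universal fibre-derivable xs))
        where
        fibre-derivable : ∀ j → Derives dec 𝒮 (A ⊗ full) (i , j)
        fibre-derivable j = rule⇒Derives dec (inj₁ (A , d , λ _ → ∧-identityʳ _)) ⊆-refl

  slice-feasible : ∀ {f} → EntropyFeasible dec 𝒮 f →
                   ∀ i → EntropyFeasible dec₂ 𝒮₂ (λ B → f (⁅ dec₁ ⁆ i ⊗ B))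
  slice-feasible F i = polymatroid⇒feasible (slice-polymatroid (feasible⇒polymatroid F) i) λ j →
    ≤-trans (monotone _ _ (λ x t → ⁅⁆-complete dec (⁅⁆-⊗-sound t))) (singleton (i , j))
    where open EntropyFeasible F

0-feasible : ∀ {X} {dec : DecidableEquality X} {𝒮 : Spanoid X} → EntropyFeasible dec 𝒮 (λ _ → 0ℚ)
0-feasible = record
  { empty     = refl
  ; singleton = λ _ → 0≤1
  ; submod    = λ _ _ → ≤-refl
  ; monotone  = λ _ _ _ → ≤-refl
  ; closed    = λ _ _ _ → refl
  }

lpEntropy-nonNeg : ∀ {X} {dec : DecidableEquality X} {𝒮 : Spanoid X} {v} →
                   IsLPEntropy dec 𝒮 v → 0ℚ ≤ v
lpEntropy-nonNeg (_ , v-max) = v-max _ 0-feasible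

mainTheorem20 : ∀ (n₁ n₂ : ℕ) (𝒮₁ : Spanoid (Fin n₁)) (𝒮₂ : Spanoid (Fin n₂)) (v₁ v₂ v : ℚ) →
    IsLPEntropy _≟_ 𝒮₁ v₁ → IsLPEntropy _≟_ 𝒮₂ v₂ →
    IsLPEntropy (×-dec _≟_ _≟_) (semidirect _≟_ _≟_ 𝒮₁ 𝒮₂) v →
    v ≤ v₁ * v₂
mainTheorem20 n₁ n₂ 𝒮₁ 𝒮₂ v₁ v₂ v (_ , v₁-max) LP₂@(_ , v₂-max) ((f , F , f-full≡v) , _) =
  subst (_≤ v₁ * v₂) f-full≡v (≤-*-by-scaling (lpEntropy-nonNeg LP₂) scaled-cylinder-bound)
  where
  open SemidirectProduct _≟_ _≟_ 𝒮₁ 𝒮₂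

  slice-bound : ∀ i → f (⁅ _≟_ ⁆ i ⊗ full) ≤ v₂
  slice-bound i = v₂-max _ (slice-feasible F i)

  scaled-cylinder-bound : ∀ l → 0ℚ ≤ l → l * v₂ ≤ 1ℚ → l * f full ≤ v₁
  scaled-cylinder-bound l l≥0 lv₂≤1 = v₁-max _ (polymatroid⇒feasible
    (scale-polymatroid l≥0 (cylinder-polymatroid (feasible⇒polymatroid F) (allFin n₂) ∈-allFin))
    (λ i → ≤-trans (*-monoˡ-≤-nonNeg l {{nonNegative l≥0}} (slice-bound i)) lv₂≤1))
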